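{- Let $H$ be a ribbon hypermap and $e\in E(H)$. Then $$\lvert \varepsilon(H)-\varepsilon(H^{\{e\}})\rvert\leqslant 2(d(e)-1).$$
   Context: A ribbon hypermap $H$ is a (possibly non-orientable) surface with boundary, written as the union of two sets of discs, the hypervertices $V(H)$ and the hyperedges $E(H)$, such that hypervertices and hyperedges meet in disjoint line segments (common line segments), each lying on the boundary of exactly one hypervertex and exactly one hyperedge. Hyperfaces are the boundary components of the surface. $v(H),e(H),f(H),k(H)$ are the numbers of hypervertices, hyperedges, hyperfaces and connected components; $d(e)$ is the number of common line segments on hyperedge $e$ and $d(H)=\sum_e d(e)$. The Euler genus is $\varepsilon(H)=2k(H)+d(H)-v(H)-e(H)-f(H)$. Partial dual $H^A$ ($A\subseteq E(H)$; here $A=\{e\}$, written $H^e$ in the paper): in an arrow presentation of $H$ (hypervertices as closed curves; each hyperedge $e$ as arrows $e_1,\dots,e_{d(e)}$ along its common line segments in cyclic order around $e$), for each $e\in A$ and each $i$ draw a new arrow from the head of $e_i$ to the tail of $e_{i+1}$ (indices mod $d(e)$), label it $e_i$, and delete the original arrows; the new arrows become arcs of the closed curves of the arrow presentation of $H^A$ (equivalently, the hypervertices of $H^A$ are the boundary components of the sub-ribbon hypermap consisting of all hypervertices and the hyperedges in $A$, and the hyperedges are unchanged). -}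

module Defs where

open import Data.Bool using (Bool; true; false; _∨_; _∧_; not; if_then_else_)
open import Data.Nat using (ℕ; zero; suc; _+_; _*_; _<ᵇ_; ⌊_/2⌋)
open import Data.Fin using (Fin; toℕ) renaming (zero to fzero; suc to fsuc)
import Data.Fin as Fin
open import Data.List using (List; []; _∷_)
open import Data.Bool.ListAction using (any)
open import Data.Integer using (ℤ; +_; _-_)
open import Relation.Nullary.Decidable using (isYes)
open import Relation.Binary.PropositionalEquality using (_≡_; _≢_)
open import Function using (_∘_)

-- Combinatorial model of ribbon hypermaps (flag / "3 involutions" model).
--
-- A flag is an endpoint of a common line segment (2 flags per segment).
--   τ₂ : swaps the two endpoints of a common line segment;
--   τ₁ : follows the free boundary arc of the hypervertex starting at a flag;
--   τ₀ : follows the free boundary arc of the hyperedge starting at a flag.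
-- Hypervertices = orbits of ⟨τ₁,τ₂⟩, hyperedges = orbits of ⟨τ₀,τ₂⟩,
-- hyperfaces (boundary components) = orbits of ⟨τ₀,τ₁⟩,
-- components = orbits of ⟨τ₀,τ₁,τ₂⟩.  Hypervertices meeting no hyperedge
-- carry no flags; they are recorded by the number `isolated`.

record RawHypermap : Set where
  field
    nflags   : ℕ
    τ₀ τ₁ τ₂ : Fin nflags → Fin nflags
    isolated : ℕ
open RawHypermap public

IsInvolution : ∀ {n} → (Fin n → Fin n) → Set
IsInvolution f = ∀ i → f (f i) ≡ i

FixedPointFree : ∀ {n} → (Fin n → Fin n) → Set
FixedPointFree f = ∀ i → f i ≢ i

record IsRibbonHypermap (H : RawHypermap) : Set where
  field
    inv₀ : IsInvolution (τ₀ H)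
    inv₁ : IsInvolution (τ₁ H)
    inv₂ : IsInvolution (τ₂ H)
    fpf₀ : FixedPointFree (τ₀ H)
    fpf₁ : FixedPointFree (τ₁ H)
    fpf₂ : FixedPointFree (τ₂ H)

anyFin : ∀ {n} → (Fin n → Bool) → Bool
anyFin {zero}  p = false
anyFin {suc n} p = p fzero ∨ anyFin (p ∘ fsuc)

countFin : ∀ {n} → (Fin n → Bool) → ℕ
countFin {zero}  p = 0
countFin {suc n} p = (if p fzero then 1 else 0) + countFin (p ∘ fsuc)

iterate : {A : Set} → ℕ → (A → A) → A → A
iterate zero    f a = a
iterate (suc k) f a = f (iterate k f a)

-- one closure step: add all images of the current set under the generators
-- (for involutions, preimage = image)
step : ∀ {n} → List (Fin n → Fin n) → (Fin n → Bool) → (Fin n → Bool)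
step gs S j = S j ∨ any (λ g → S (g j)) gs

-- the orbit of x (characteristic function); n steps suffice
orbit : ∀ {n} → List (Fin n → Fin n) → Fin n → (Fin n → Bool)
orbit {n} gs x = iterate n (step gs) (λ j → isYes (j Fin.≟ x))

-- number of orbits = number of flags that are least in their orbit
orbitCount : ∀ {n} → List (Fin n → Fin n) → ℕ
orbitCount gs =
  countFin (λ i → not (anyFin (λ j → (toℕ j <ᵇ toℕ i) ∧ orbit gs i j)))

v e f k d : RawHypermap → ℕ
v H = orbitCount (τ₁ H ∷ τ₂ H ∷ []) + isolated H
e H = orbitCount (τ₀ H ∷ τ₂ H ∷ [])
f H = orbitCount (τ₀ H ∷ τ₁ H ∷ []) + isolated H
k H = orbitCount (τ₀ H ∷ τ₁ H ∷ τ₂ H ∷ []) + isolated H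
d H = ⌊ nflags H /2⌋

eulerGenus : RawHypermap → ℤ
eulerGenus H = + (2 * k H + d H) - + (v H + e H + f H)

inHyperedge : (H : RawHypermap) → Fin (nflags H) → Fin (nflags H) → Bool
inHyperedge H x = orbit (τ₀ H ∷ τ₂ H ∷ []) x

degree : (H : RawHypermap) → Fin (nflags H) → ℕ
degree H x = ⌊ countFin (inHyperedge H x) /2⌋

-- Partial dual with respect to the single hyperedge containing flag x:
-- on the flags of that hyperedge the roles of common line segments (τ₂)
-- and free hyperedge-boundary arcs (τ₀) are exchanged; τ₁ is unchanged.
partialDual : (H : RawHypermap) → Fin (nflags H) → RawHypermap
partialDual H x = record
  { nflags   = nflags H
  ; τ₀       = λ j → if inHyperedge H x j then τ₂ H j else τ₀ H j
  ; τ₁       = τ₁ H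
  ; τ₂       = λ j → if inHyperedge H x j then τ₀ H j else τ₂ H j
  ; isolated = isolated H
  }

-- The partial dual H^e exchanges the generators τ₀ and τ₂ on the flags of the
-- hyperedge e and changes nothing else.  On these flags τ₀ and τ₂ are
-- fixed-point-free involutions, so in H as well as in H^e every vertex (orbit of
-- ⟨τ₁,τ₂⟩) or face (orbit of ⟨τ₀,τ₁⟩) meeting e contains at least two of the
-- 2 d(e) flags of e: at most d(e) of them meet e.  Merging all orbits that meet
-- e into one thus loses at most d(e) - 1 orbits, and after this merge the vertex
-- (resp. face) orbits of H and of H^e coincide, because their generators agree
-- off e.  Hence v and f change by at most d(e) - 1, while e and k do not change,
-- since on every flag τ₀, τ₂ of H^e are τ₀, τ₂ of H, possibly swapped.

module Submission where

open import Defs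
open import Level using (0ℓ)
open import Data.Bool using (Bool; true; false; T; T?; _∨_; _∧_; not; if_then_else_)
open import Data.Bool.Properties using (T-∧; T-∨; T-≡; T-not-≡; ∧-zeroʳ; not-involutive; ⇔→≡)
open import Data.Nat using (ℕ; zero; suc; _+_; _*_; _∸_; _≤_; _<_; z≤n; s≤s; _<ᵇ_; ⌊_/2⌋)
open import Data.Nat.Properties
import Data.Nat.Tactic.RingSolver as ℕ-Solver
open import Data.Integer using (ℤ; ∣_∣; _-_)
import Data.Integer as ℤ
import Data.Integer.Properties as ℤₚ
import Data.Integer.Tactic.RingSolver as ℤ-Solver
open import Data.Fin using (Fin; toℕ) renaming (zero to fzero; suc to fsuc)
import Data.Fin as Fin
import Data.Fin.Properties as Finₚ
open import Data.List using (List; []; _∷_; _++_)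
open import Data.List.Relation.Unary.Any as Any using (Any; here; there)
open import Data.List.Relation.Unary.Any.Properties using (any⁺; any⁻; ++⁺ˡ; ++⁺ʳ; ++⁻)
open import Data.List.Relation.Unary.All using (All; []; _∷_)
open import Data.List.Relation.Binary.Pointwise using (Pointwise; []; _∷_)
open import Data.Product using (∃-syntax; _×_; _,_; proj₁; proj₂)
open import Data.Sum using (_⊎_; inj₁; inj₂)
import Data.Sum as Sum
open import Data.Empty using (⊥-elim)
open import Function using (_∘_)
open import Function.Bundles using (Equivalence; mk⇔)
open import Relation.Nullary using (¬_; yes; no)
open import Relation.Nullary.Decidable using (isYes; toWitness; fromWitness)
open import Relation.Binary using (Rel; _⇒_; IsEquivalence; tri<; tri≈; tri>)
open import Relation.Binary.Construct.Closure.ReflexiveTransitive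
  using (Star; ε; _◅_; _◅◅_; reverse) renaming (map to Star-map)
open import Relation.Binary.PropositionalEquality
open import Algebra.Properties.CommutativeSemigroup +-commutativeSemigroup
  using (xy∙z≈xz∙y)
open import Algebra.Properties.Semiring.Sum +-*-semiring
  using (sum; sum-cong-≗; ∑-distrib-+; ∑-comm; *-distribˡ-sum)

open Equivalence using (to; from)

m<n⇒m≤n∸1 : ∀ {m n} → m < n → m ≤ n ∸ 1
m<n⇒m≤n∸1 (s≤s m≤n) = m≤n

2*m≤n⇒m≤⌊n/2⌋ : ∀ {m n} → 2 * m ≤ n → m ≤ ⌊ n /2⌋
2*m≤n⇒m≤⌊n/2⌋ {m} {n} 2m≤n = begin
  m              ≡⟨ n≡⌊n+n/2⌋ m ⟩
  ⌊ m + m /2⌋     ≡⟨ cong (λ l → ⌊ m + l /2⌋) (+-identityʳ m) ⟨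
  ⌊ 2 * m /2⌋     ≤⟨ ⌊n/2⌋-mono 2m≤n ⟩
  ⌊ n /2⌋         ∎
  where open ≤-Reasoning

+-monoˡ-≤-slack : ∀ {a b c} i → a ≤ b + c → a + i ≤ b + i + c
+-monoˡ-≤-slack {b = b} {c} i a≤b+c =
  ≤-trans (+-monoˡ-≤ i a≤b+c) (≤-reflexive (xy∙z≈xz∙y b c i))

+-mono-≤-slack : ∀ {a a′ b b′ m c} → a ≤ a′ + c → b ≤ b′ + c → a + m + b ≤ a′ + m + b′ + 2 * c
+-mono-≤-slack {a′ = a′} {b′ = b′} {m} {c} a≤ b≤ =
  ≤-trans (+-mono-≤ (+-monoˡ-≤ m a≤) b≤) (≤-reflexive (rearrange a′ m b′ c))
  where
  rearrange : ∀ a m b c → a + c + m + (b + c) ≡ a + m + b + 2 * c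
  rearrange = ℕ-Solver.solve-∀

∣+m-+n∣≤ : ∀ {m n c} → m ≤ n + c → n ≤ m + c → ∣ ℤ.+ m - ℤ.+ n ∣ ≤ c
∣+m-+n∣≤ {m} {n} m≤n+c n≤m+c rewrite ℤₚ.m-n≡m⊖n m n with ≤-total n m
... | inj₁ n≤m rewrite ℤₚ.⊖-≥ n≤m = m≤n+o⇒m∸n≤o m n m≤n+c
... | inj₂ m≤n rewrite ℤₚ.∣⊖∣-≤ m≤n = m≤n+o⇒m∸n≤o n m n≤m+c

indicator : Bool → ℕ
indicator b = if b then 1 else 0

_⊆_ : {A : Set} → (A → Bool) → (A → Bool) → Set
p ⊆ q = ∀ i → T (p i) → T (q i)

¬T⇒≡false : ∀ {b} → ¬ T b → b ≡ false
¬T⇒≡false {false} _  = refl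
¬T⇒≡false {true}  ¬t = ⊥-elim (¬t _)

indicator≤1 : ∀ b → indicator b ≤ 1
indicator≤1 false = z≤n
indicator≤1 true  = ≤-refl

indicator-mono : ∀ {a b} → (T a → T b) → indicator a ≤ indicator b
indicator-mono {false}         _   = z≤n
indicator-mono {true}  {true}  _   = ≤-refl
indicator-mono {true}  {false} a⇒b = ⊥-elim (a⇒b _)

sum-mono-≤ : ∀ {n} {f g : Fin n → ℕ} → (∀ i → f i ≤ g i) → sum f ≤ sum g
sum-mono-≤ {zero}  _   = z≤n
sum-mono-≤ {suc n} f≤g = +-mono-≤ (f≤g fzero) (sum-mono-≤ (f≤g ∘ fsuc))

countFin≡sum : ∀ {n} (p : Fin n → Bool) → countFin p ≡ sum (indicator ∘ p)
countFin≡sum {zero}  p = refl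
countFin≡sum {suc n} p = cong (indicator (p fzero) +_) (countFin≡sum (p ∘ fsuc))

countFin-cong : ∀ {n} {p q : Fin n → Bool} → (∀ i → p i ≡ q i) → countFin p ≡ countFin q
countFin-cong {zero}  _   = refl
countFin-cong {suc n} p≗q =
  cong₂ _+_ (cong indicator (p≗q fzero)) (countFin-cong (p≗q ∘ fsuc))

countFin-mono : ∀ {n} {p q : Fin n → Bool} → p ⊆ q → countFin p ≤ countFin q
countFin-mono {zero}  _   = z≤n
countFin-mono {suc n} p⊆q =
  +-mono-≤ (indicator-mono (p⊆q fzero)) (countFin-mono (p⊆q ∘ fsuc))

countFin≤n : ∀ {n} (p : Fin n → Bool) → countFin p ≤ n
countFin≤n {zero}  p = z≤n
countFin≤n {suc n} p = +-mono-≤ (indicator≤1 (p fzero)) (countFin≤n (p ∘ fsuc))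

countFin-positive : ∀ {n} (p : Fin n → Bool) {i} → T (p i) → 1 ≤ countFin p
countFin-positive p {fzero} p₀ with p fzero
... | true  = s≤s z≤n
... | false = ⊥-elim p₀
countFin-positive p {fsuc i} pᵢ =
  ≤-trans (countFin-positive (p ∘ fsuc) pᵢ) (m≤n+m _ (indicator (p fzero)))

countFin-none : ∀ {n} {p : Fin n → Bool} → (∀ i → ¬ T (p i)) → countFin p ≡ 0
countFin-none {zero}          _    = refl
countFin-none {suc n} {p} none with p fzero | none fzero
... | true  | ¬p₀ = ⊥-elim (¬p₀ _)
... | false | _   = countFin-none (none ∘ fsuc)

countFin-≤1 : ∀ {n} {p : Fin n → Bool} →
  (∀ {i j} → T (p i) → T (p j) → i ≡ j) → countFin p ≤ 1
countFin-≤1 {zero}          _      = z≤n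
countFin-≤1 {suc n} {p} unique with p fzero in p₀
... | true  = ≤-reflexive (cong suc (countFin-none {p = p ∘ fsuc} λ i pᵢ →
                Finₚ.0≢1+n (unique (subst T (sym p₀) _) pᵢ)))
... | false = countFin-≤1 (λ pᵢ pⱼ → Finₚ.suc-injective (unique pᵢ pⱼ))

countFin-split : ∀ {n} (p q : Fin n → Bool) →
  countFin p ≡ countFin (λ i → p i ∧ q i) + countFin (λ i → p i ∧ not (q i))
countFin-split p q = begin
  countFin p
    ≡⟨ countFin≡sum p ⟩
  sum (indicator ∘ p)
    ≡⟨ sum-cong-≗ (λ i → indicator-split (p i) (q i)) ⟩
  sum (λ i → indicator (p i ∧ q i) + indicator (p i ∧ not (q i)))
    ≡⟨ ∑-distrib-+ (λ i → indicator (p i ∧ q i)) (λ i → indicator (p i ∧ not (q i))) ⟩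
  sum (λ i → indicator (p i ∧ q i)) + sum (λ i → indicator (p i ∧ not (q i)))
    ≡⟨ cong₂ _+_ (countFin≡sum (λ i → p i ∧ q i)) (countFin≡sum (λ i → p i ∧ not (q i))) ⟨
  countFin (λ i → p i ∧ q i) + countFin (λ i → p i ∧ not (q i)) ∎
  where
  open ≡-Reasoning
  indicator-split : ∀ a b → indicator a ≡ indicator (a ∧ b) + indicator (a ∧ not b)
  indicator-split false _     = refl
  indicator-split true  false = refl
  indicator-split true  true  = refl

countFin-⊆-split : ∀ {n} {p q : Fin n → Bool} → p ⊆ q →
  countFin q ≡ countFin p + countFin (λ i → q i ∧ not (p i))
countFin-⊆-split {p = p} {q} p⊆q =
  trans (countFin-split q p) (cong (_+ countFin (λ i → q i ∧ not (p i))) (countFin-cong q∧p≡p))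
  where
  q∧p≡p : ∀ i → q i ∧ p i ≡ p i
  q∧p≡p i with p i | p⊆q i
  ... | false | _    = ∧-zeroʳ (q i)
  ... | true  | p⇒q rewrite to T-≡ (p⇒q _) = refl

countFin-< : ∀ {n} {p q : Fin n → Bool} → p ⊆ q →
  ∀ {j} → T (q j) → ¬ T (p j) → countFin p < countFin q
countFin-< {n} {p} {q} p⊆q {j} qⱼ ¬pⱼ = begin-strict
  countFin p                     <⟨ m<m+n (countFin p) (countFin-positive q∖p qⱼ∖pⱼ) ⟩
  countFin p + countFin q∖p      ≡⟨ countFin-⊆-split p⊆q ⟨
  countFin q                     ∎
  where
  open ≤-Reasoning
  q∖p : Fin n → Bool
  q∖p i = q i ∧ not (p i)
  qⱼ∖pⱼ : T (q∖p j)
  qⱼ∖pⱼ = from T-∧ (qⱼ , from T-not-≡ (¬T⇒≡false ¬pⱼ))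

countFin-≥2 : ∀ {n} (p : Fin n → Bool) {i j} → i ≢ j → T (p i) → T (p j) → 2 ≤ countFin p
countFin-≥2 {n} p {i} {j} i≢j pᵢ pⱼ =
  ≤-trans (s≤s (countFin-positive single {i} (fromWitness refl)))
          (countFin-< single⊆p pⱼ (λ jᵢ → i≢j (sym (toWitness jᵢ))))
  where
  single : Fin n → Bool
  single k = isYes (k Fin.≟ i)
  single⊆p : single ⊆ p
  single⊆p k kᵢ = subst (T ∘ p) (sym (toWitness kᵢ)) pᵢ

⊆-by-countFin : ∀ {n} {p q : Fin n → Bool} → p ⊆ q → countFin q ≤ countFin p → q ⊆ p
⊆-by-countFin {p = p} p⊆q q≤p j qⱼ with p j in pⱼ
... | true  = _
... | false = ⊥-elim (<⇒≱ (countFin-< p⊆q qⱼ (subst T pⱼ)) q≤p)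

minimal-witness : ∀ {n} (p : Fin n → Bool) {i} → T (p i) →
  ∃[ u ] T (p u) × (∀ j → toℕ j < toℕ u → ¬ T (p j))
minimal-witness {suc n} p {i} pᵢ with p fzero in p₀
... | true  = fzero , subst T (sym p₀) _ , λ _ ()
... | false with i | pᵢ
...   | fzero  | p₀′ = ⊥-elim (subst T p₀ p₀′)
...   | fsuc i | pᵢ′ with minimal-witness (p ∘ fsuc) pᵢ′
...     | u , pᵤ , below = fsuc u , pᵤ , λ where
          fzero    _         → subst T p₀
          (fsuc j) (s≤s j<u) → below j j<u

anyFin⁺ : ∀ {n} (p : Fin n → Bool) {i} → T (p i) → T (anyFin p)
anyFin⁺ p {fzero}  p₀ = from T-∨ (inj₁ p₀)
anyFin⁺ p {fsuc i} pᵢ = from T-∨ (inj₂ (anyFin⁺ (p ∘ fsuc) pᵢ))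

anyFin⁻ : ∀ {n} (p : Fin n → Bool) → T (anyFin p) → ∃[ i ] T (p i)
anyFin⁻ {suc n} p h with to T-∨ h
... | inj₁ p₀   = fzero , p₀
... | inj₂ pₛ with anyFin⁻ (p ∘ fsuc) pₛ
...   | i , pᵢ = fsuc i , pᵢ

double-counting : ∀ {m n} c (R : Fin m → Fin n → Bool) (P : Fin m → Bool) (Q : Fin n → Bool) →
  (∀ i → T (P i) → c ≤ countFin (R i)) →
  (∀ {i a} → T (R i a) → T (Q a)) →
  (∀ {i i′ a} → T (R i a) → T (R i′ a) → i ≡ i′) →
  c * countFin P ≤ countFin Q
double-counting c R P Q many inQ functional = begin
  c * countFin P                             ≡⟨ cong (c *_) (countFin≡sum P) ⟩
  c * sum (indicator ∘ P)                    ≡⟨ *-distribˡ-sum c (indicator ∘ P) ⟩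
  sum (λ i → c * indicator (P i))            ≤⟨ sum-mono-≤ row ⟩
  sum (λ i → sum (λ a → indicator (R i a)))  ≡⟨ ∑-comm (λ i a → indicator (R i a)) ⟩
  sum (λ a → sum (λ i → indicator (R i a)))  ≤⟨ sum-mono-≤ column ⟩
  sum (indicator ∘ Q)                        ≡⟨ countFin≡sum Q ⟨
  countFin Q                                 ∎
  where
  open ≤-Reasoning
  row : ∀ i → c * indicator (P i) ≤ sum (λ a → indicator (R i a))
  row i with P i | many i
  ... | false | _     = ≤-trans (≤-reflexive (*-zeroʳ c)) z≤n
  ... | true  | manyᵢ rewrite *-identityʳ c | sym (countFin≡sum (R i)) = manyᵢ _
  column : ∀ a → sum (λ i → indicator (R i a)) ≤ indicator (Q a)
  column a rewrite sym (countFin≡sum (λ i → R i a)) with Q a in Qₐ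
  ... | true  = countFin-≤1 functional
  ... | false = ≤-reflexive (countFin-none {p = λ i → R i a} (λ i → subst T Qₐ ∘ inQ))

-- Orbits

module _ {n} (F : (Fin n → Bool) → (Fin n → Bool))
         (inflationary : ∀ A → A ⊆ F A)
         (monotone : ∀ {A B} → A ⊆ B → F A ⊆ F B) where

  iterate-inflationary : ∀ k {A} → A ⊆ iterate k F A
  iterate-inflationary zero    j Aⱼ = Aⱼ
  iterate-inflationary (suc k) j Aⱼ = inflationary _ j (iterate-inflationary k j Aⱼ)

  iterate-grows-or-stable : ∀ {A x} → T (A x) → ∀ k →
    suc k ≤ countFin (iterate k F A) ⊎ F (iterate k F A) ⊆ iterate k F A
  iterate-grows-or-stable {A} Aₓ zero = inj₁ (countFin-positive A Aₓ)
  iterate-grows-or-stable {A} Aₓ (suc k) with iterate-grows-or-stable Aₓ k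
  ... | inj₂ stable = inj₂ (monotone stable)
  ... | inj₁ grows with countFin (F (iterate k F A)) ≤? countFin (iterate k F A)
  ...   | yes shrinks = inj₂ (monotone (⊆-by-countFin (inflationary _) shrinks))
  ...   | no  ¬shrinks = inj₁ (≤-trans (s≤s grows) (≰⇒> ¬shrinks))

  -- n iterations suffice because a strictly growing subset of Fin n would
  -- exceed n elements.
  iterate-stable : ∀ {A x} → T (A x) → F (iterate n F A) ⊆ iterate n F A
  iterate-stable Aₓ with iterate-grows-or-stable Aₓ n
  ... | inj₁ grows  = ⊥-elim (<⇒≱ grows (countFin≤n _))
  ... | inj₂ stable = stable

Move : ∀ {n} → List (Fin n → Fin n) → Rel (Fin n) 0ℓ
Move gs a b = Any (λ g → g a ≡ b) gs

module _ {n} (gs : List (Fin n → Fin n)) where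

  step-inflationary : ∀ A → A ⊆ step gs A
  step-inflationary A j Aⱼ = from T-∨ (inj₁ Aⱼ)

  step-monotone : ∀ {A B} → A ⊆ B → step gs A ⊆ step gs B
  step-monotone A⊆B j h with to T-∨ h
  ... | inj₁ Aⱼ   = from T-∨ (inj₁ (A⊆B j Aⱼ))
  ... | inj₂ anyA = from T-∨ (inj₂ (any⁺ _ (Any.map (λ {g} → A⊆B (g j)) (any⁻ _ gs anyA))))

  step-Move⁺ : ∀ {A a b} → Move gs a b → T (A b) → T (step gs A a)
  step-Move⁺ {A} mv Aᵦ =
    from T-∨ (inj₂ (any⁺ _ (Any.map (λ ga≡b → subst (T ∘ A) (sym ga≡b) Aᵦ) mv)))

  step-Move⁻ : ∀ {A a} → T (step gs A a) → T (A a) ⊎ ∃[ b ] Move gs a b × T (A b)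
  step-Move⁻ {A} {a} h = Sum.map₂ (move ∘ any⁻ _ gs) (to T-∨ h)
    where
    move : ∀ {hs} → Any (λ g → T (A (g a))) hs → ∃[ b ] Move hs a b × T (A b)
    move (here Aᵍᵃ) = _ , here refl , Aᵍᵃ
    move (there m) with move m
    ... | b , mv , Aᵦ = b , there mv , Aᵦ

  -- orbit gs x is computed by closing {x} under preimages, hence the
  -- direction of the paths below.
  orbit-sound : ∀ {x j} → T (orbit gs x j) → Star (Move gs) j x
  orbit-sound {x} = sound n
    where
    sound : ∀ k {j} → T (iterate k (step gs) (λ i → isYes (i Fin.≟ x)) j) → Star (Move gs) j x
    sound zero    jₓ with toWitness jₓ
    ... | refl = ε
    sound (suc k) h with step-Move⁻ h
    ... | inj₁ old          = sound k old
    ... | inj₂ (_ , mv , Aᵦ) = mv ◅ sound k Aᵦ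

  orbit-complete : ∀ {x j} → Star (Move gs) j x → T (orbit gs x j)
  orbit-complete {x} ε =
    iterate-inflationary (step gs) step-inflationary step-monotone n x (fromWitness refl)
  orbit-complete {x} {j} (mv ◅ path) =
    iterate-stable (step gs) step-inflationary step-monotone {x = x} (fromWitness refl) j
      (step-Move⁺ mv (orbit-complete path))

Move-sym : ∀ {n} {gs : List (Fin n → Fin n)} → All IsInvolution gs →
  ∀ {a b} → Move gs a b → Move gs b a
Move-sym {gs = g ∷ _} (invᵍ ∷ _) {a} (here ga≡b) = here (trans (cong g (sym ga≡b)) (invᵍ a))
Move-sym (_ ∷ invs) (there mv) = there (Move-sym invs mv)

⟦_⟧ : ∀ {n} → (Fin n → Fin n → Bool) → Rel (Fin n) 0ℓ
⟦ r ⟧ i j = T (r i j)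

module _ {n} {gs : List (Fin n → Fin n)} (invs : All IsInvolution gs) where

  orbit-isEquivalence : IsEquivalence ⟦ orbit gs ⟧
  orbit-isEquivalence = record
    { refl  = orbit-complete gs ε
    ; sym   = orbit-complete gs ∘ reverse (Move-sym invs) ∘ orbit-sound gs
    ; trans = λ i~j j~l → orbit-complete gs (orbit-sound gs j~l ◅◅ orbit-sound gs i~j)
    }

  orbit-resp-Move : ∀ {x a b} → Move gs a b → orbit gs x a ≡ orbit gs x b
  orbit-resp-Move mv = ⇔→≡ (mk⇔
    (to T-≡ ∘ orbit-complete gs ∘ (Move-sym invs mv ◅_) ∘ orbit-sound gs ∘ from T-≡)
    (to T-≡ ∘ orbit-complete gs ∘ (mv ◅_) ∘ orbit-sound gs ∘ from T-≡))

isLeast : ∀ {n} → (Fin n → Fin n → Bool) → Fin n → Bool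
isLeast r i = not (anyFin (λ j → (toℕ j <ᵇ toℕ i) ∧ r i j))

-- orbitCount gs is classCount (orbit gs) by definition.
classCount : ∀ {n} → (Fin n → Fin n → Bool) → ℕ
classCount r = countFin (isLeast r)

module _ {n} {r : Fin n → Fin n → Bool} where

  isLeast⇒ : ∀ {i j} → T (isLeast r i) → toℕ j < toℕ i → ¬ T (r i j)
  isLeast⇒ {i} {j} leastᵢ j<i rᵢⱼ =
    subst T (to T-not-≡ leastᵢ) (anyFin⁺ _ {j} (from T-∧ (<⇒<ᵇ j<i , rᵢⱼ)))

  isLeast⁺ : ∀ {i} → (∀ j → toℕ j < toℕ i → ¬ T (r i j)) → T (isLeast r i)
  isLeast⁺ {i} none with anyFin (λ j → (toℕ j <ᵇ toℕ i) ∧ r i j) in earlier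
  ... | false = _
  ... | true with anyFin⁻ _ (from T-≡ earlier)
  ...   | j , h with to T-∧ h
  ...     | j<ᵇi , rᵢⱼ = none j (<ᵇ⇒< _ _ j<ᵇi) rᵢⱼ

  isLeast⁻ : ∀ {i} → T (not (isLeast r i)) → ∃[ j ] toℕ j < toℕ i × T (r i j)
  isLeast⁻ {i} h with anyFin⁻ _ (subst T (not-involutive _) h)
  ... | j , h′ with to T-∧ h′
  ...   | j<ᵇi , rᵢⱼ = j , <ᵇ⇒< _ _ j<ᵇi , rᵢⱼ

  isLeast-unique : IsEquivalence ⟦ r ⟧ → ∀ {i i′} → T (r i i′) →
    T (isLeast r i) → T (isLeast r i′) → i ≡ i′
  isLeast-unique r-equiv {i} {i′} rᵢᵢ′ leastᵢ leastᵢ′ with <-cmp (toℕ i) (toℕ i′)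
  ... | tri< i<i′ _ _ = ⊥-elim (isLeast⇒ leastᵢ′ i<i′ (IsEquivalence.sym r-equiv rᵢᵢ′))
  ... | tri≈ _ i≡i′ _ = Finₚ.toℕ-injective i≡i′
  ... | tri> _ _ i′<i = ⊥-elim (isLeast⇒ leastᵢ i′<i rᵢᵢ′)

isLeast-antitone : ∀ {n} {r s : Fin n → Fin n → Bool} → ⟦ r ⟧ ⇒ ⟦ s ⟧ → isLeast s ⊆ isLeast r
isLeast-antitone {r = r} {s} r⇒s i leastᵢ =
  isLeast⁺ {r = r} (λ j j<i → isLeast⇒ {r = s} leastᵢ j<i ∘ r⇒s)

classCount-antitone : ∀ {n} {r s : Fin n → Fin n → Bool} → ⟦ r ⟧ ⇒ ⟦ s ⟧ →
  classCount s ≤ classCount r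
classCount-antitone = countFin-mono ∘ isLeast-antitone

classCount-cong : ∀ {n} {r s : Fin n → Fin n → Bool} → ⟦ r ⟧ ⇒ ⟦ s ⟧ → ⟦ s ⟧ ⇒ ⟦ r ⟧ →
  classCount r ≡ classCount s
classCount-cong {r = r} {s} r⇒s s⇒r =
  ≤-antisym (classCount-antitone {r = s} {r} s⇒r) (classCount-antitone {r = r} {s} r⇒s)

orbitCount-cong : ∀ {n} {gs gs′ : List (Fin n → Fin n)} → Move gs ⇒ Move gs′ → Move gs′ ⇒ Move gs →
  orbitCount gs ≡ orbitCount gs′
orbitCount-cong {gs = gs} {gs′} gs⇒gs′ gs′⇒gs = classCount-cong {r = orbit gs} {orbit gs′}
  (orbit-complete gs′ ∘ Star-map gs⇒gs′ ∘ orbit-sound gs)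
  (orbit-complete gs ∘ Star-map gs′⇒gs ∘ orbit-sound gs′)

-- Merging all classes that meet a set E

meets : ∀ {n} → (Fin n → Fin n → Bool) → (Fin n → Bool) → Fin n → Bool
meets r E i = anyFin (λ a → E a ∧ r i a)

merge : ∀ {n} → (Fin n → Fin n → Bool) → (Fin n → Bool) → Fin n → Fin n → Bool
merge r E i j = r i j ∨ (meets r E i ∧ meets r E j)

Partnered : ∀ {n} → (Fin n → Fin n → Bool) → (Fin n → Bool) → Set
Partnered r E = ∀ {a} → T (E a) → ∃[ b ] b ≢ a × T (E b) × T (r a b)

module Merging {n} {r : Fin n → Fin n → Bool} (r-equiv : IsEquivalence ⟦ r ⟧)
               (E : Fin n → Bool) where

  open IsEquivalence r-equiv renaming (refl to r-refl; sym to r-sym; trans to r-trans)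

  meets⁺ : ∀ {i a} → T (E a) → T (r i a) → T (meets r E i)
  meets⁺ {i} Eₐ rᵢₐ = anyFin⁺ (λ b → E b ∧ r i b) (from T-∧ (Eₐ , rᵢₐ))

  meets⁻ : ∀ {i} → T (meets r E i) → ∃[ a ] T (E a) × T (r i a)
  meets⁻ {i} Mᵢ with anyFin⁻ (λ b → E b ∧ r i b) Mᵢ
  ... | a , h = a , to T-∧ h

  meets-resp : ∀ {i j} → T (r i j) → T (meets r E i) → T (meets r E j)
  meets-resp rᵢⱼ Mᵢ with meets⁻ Mᵢ
  ... | a , Eₐ , rᵢₐ = meets⁺ Eₐ (r-trans (r-sym rᵢⱼ) rᵢₐ)

  r⇒merge : ⟦ r ⟧ ⇒ ⟦ merge r E ⟧
  r⇒merge = from T-∨ ∘ inj₁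

  merge-meets : ∀ {i j} → T (meets r E i) → T (meets r E j) → T (merge r E i j)
  merge-meets Mᵢ Mⱼ = from T-∨ (inj₂ (from T-∧ (Mᵢ , Mⱼ)))

  merge⇒meets : ∀ {i j} → T (E j) → T (merge r E i j) → T (meets r E i)
  merge⇒meets Eⱼ h with to T-∨ h
  ... | inj₁ rᵢⱼ = meets⁺ Eⱼ rᵢⱼ
  ... | inj₂ MM  = proj₁ (to T-∧ MM)

  meets-resp-merge : ∀ {i j} → T (meets r E i) → T (merge r E i j) → T (meets r E j)
  meets-resp-merge Mᵢ h with to T-∨ h
  ... | inj₁ rᵢⱼ = meets-resp rᵢⱼ Mᵢ
  ... | inj₂ MM  = proj₂ (to T-∧ MM)

  merge-respʳ : ∀ {i j l} → T (r j l) → T (merge r E i j) → T (merge r E i l)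
  merge-respʳ rⱼₗ h with to T-∨ h
  ... | inj₁ rᵢⱼ = r⇒merge (r-trans rᵢⱼ rⱼₗ)
  ... | inj₂ MM  = merge-meets (proj₁ (to T-∧ MM)) (meets-resp rⱼₗ (proj₂ (to T-∧ MM)))

  private
    L L′ M : Fin n → Bool
    L  = isLeast r
    L′ = isLeast (merge r E)
    M  = meets r E

  classes-meeting-E : Partnered r E →
    countFin (λ i → L i ∧ M i) ≤ ⌊ countFin E /2⌋
  classes-meeting-E partner = 2*m≤n⇒m≤⌊n/2⌋ (double-counting 2 R _ E many inE functional)
    where
    R : Fin n → Fin n → Bool
    R i a = L i ∧ (r i a ∧ E a)
    many : ∀ i → T (L i ∧ M i) → 2 ≤ countFin (R i)
    many i h with to T-∧ h
    ... | Lᵢ , Mᵢ with meets⁻ Mᵢ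
    ...   | a , Eₐ , rᵢₐ with partner Eₐ
    ...     | b , b≢a , Eᵦ , rₐᵦ = countFin-≥2 (R i) (b≢a ∘ sym)
                  (from T-∧ (Lᵢ , from T-∧ (rᵢₐ , Eₐ)))
                  (from T-∧ (Lᵢ , from T-∧ (r-trans rᵢₐ rₐᵦ , Eᵦ)))
    inE : ∀ {i a} → T (R i a) → T (E a)
    inE {i} {a} Rᵢₐ = proj₂ (to (T-∧ {r i a}) (proj₂ (to (T-∧ {L i}) Rᵢₐ)))
    functional : ∀ {i i′ a} → T (R i a) → T (R i′ a) → i ≡ i′
    functional Rᵢₐ Rᵢ′ₐ with to T-∧ Rᵢₐ | to T-∧ Rᵢ′ₐ
    ... | Lᵢ , h | Lᵢ′ , h′ = isLeast-unique r-equiv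
      (r-trans (proj₁ (to T-∧ h)) (r-sym (proj₁ (to T-∧ h′)))) Lᵢ Lᵢ′

  classCount≤merge : Partnered r E →
    ∀ {x} → T (E x) → classCount r ≤ classCount (merge r E) + (⌊ countFin E /2⌋ ∸ 1)
  classCount≤merge partner {x} Eₓ = begin
    classCount r
      ≡⟨ countFin-⊆-split L′⊆L ⟩
    classCount (merge r E) + countFin lost
      ≤⟨ +-monoʳ-≤ _ (m<n⇒m≤n∸1 lost<reps) ⟩
    classCount (merge r E) + (countFin reps ∸ 1)
      ≤⟨ +-monoʳ-≤ _ (∸-monoˡ-≤ 1 (classes-meeting-E partner)) ⟩
    classCount (merge r E) + (⌊ countFin E /2⌋ ∸ 1) ∎
    where
    open ≤-Reasoning
    lost reps : Fin n → Bool
    lost i = L i ∧ not (L′ i)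
    reps i = L i ∧ M i
    L′⊆L : L′ ⊆ L
    L′⊆L = isLeast-antitone {r = r} {merge r E} r⇒merge
    lost⊆reps : lost ⊆ reps
    lost⊆reps i h with to (T-∧ {L i}) h
    ... | Lᵢ , ¬L′ᵢ with isLeast⁻ {r = merge r E} ¬L′ᵢ
    ...   | j , j<i , mergeᵢⱼ with to T-∨ mergeᵢⱼ
    ...     | inj₁ rᵢⱼ = ⊥-elim (isLeast⇒ {r = r} Lᵢ j<i rᵢⱼ)
    ...     | inj₂ MM  = from T-∧ (Lᵢ , proj₁ (to T-∧ MM))
    lost<reps : countFin lost < countFin reps
    lost<reps with minimal-witness M (meets⁺ Eₓ r-refl)
    ... | u , Mᵤ , below = countFin-< lost⊆reps (from T-∧ (L′⊆L u L′ᵤ , Mᵤ))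
                             (λ lostᵤ → subst T (to T-not-≡ (proj₂ (to T-∧ lostᵤ))) L′ᵤ)
      where
      L′ᵤ : T (L′ u)
      L′ᵤ = isLeast⁺ {r = merge r E} λ j j<u mergeᵤⱼ → below j j<u (meets-resp-merge Mᵤ mergeᵤⱼ)

-- Changing the generators only inside a set E

AgreeOutside : ∀ {n} → (Fin n → Bool) → (Fin n → Fin n) → (Fin n → Fin n) → Set
AgreeOutside E g g′ = ∀ a → g′ a ≡ g a ⊎ (T (E a) × T (E (g a)))

agreeOutside : ∀ {n} {E : Fin n → Bool} {g g′ : Fin n → Fin n} →
  (∀ a → ¬ T (E a) → g′ a ≡ g a) → (∀ a → E (g a) ≡ E a) → AgreeOutside E g g′
agreeOutside {E = E} off preserves a with E a in Eₐ
... | true  = inj₂ (_ , subst T (sym (trans (preserves a) Eₐ)) _)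
... | false = inj₁ (off a (subst T Eₐ))

PerfectMatchingOn : ∀ {n} → (Fin n → Bool) → (Fin n → Fin n) → Set
PerfectMatchingOn E g = ∀ a → T (E a) → g a ≢ a × T (E (g a))

perfectMatchingOn : ∀ {n} {E : Fin n → Bool} {g : Fin n → Fin n} →
  FixedPointFree g → (∀ a → E (g a) ≡ E a) → PerfectMatchingOn E g
perfectMatchingOn fpf preserves a Eₐ = fpf a , subst T (sym (preserves a)) Eₐ

module _ {n} {E : Fin n → Bool} where

  moves-agree : ∀ {gs gs′ : List (Fin n → Fin n)} → Pointwise (AgreeOutside E) gs gs′ →
    ∀ {a b} → Move gs a b → Move gs′ a b ⊎ (T (E a) × T (E b))
  moves-agree (g≈g′ ∷ _) {a} (here ga≡b) with g≈g′ a
  ... | inj₁ g′a≡ga       = inj₁ (here (trans g′a≡ga ga≡b))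
  ... | inj₂ (Eₐ , E[ga]) = inj₂ (Eₐ , subst (T ∘ E) ga≡b E[ga])
  moves-agree (_ ∷ gs≈gs′) (there mv) = Sum.map₁ there (moves-agree gs≈gs′ mv)

  matching-move : ∀ {gs : List (Fin n → Fin n)} → Any (PerfectMatchingOn E) gs →
    ∀ {a} → T (E a) → ∃[ b ] b ≢ a × T (E b) × Move gs a b
  matching-move (here matching) {a} Eₐ =
    _ , proj₁ (matching a Eₐ) , proj₂ (matching a Eₐ) , here refl
  matching-move (there m) Eₐ with matching-move m Eₐ
  ... | b , b≢a , Eᵦ , mv = b , b≢a , Eᵦ , there mv

  module _ {gs gs′ : List (Fin n → Fin n)} (invs′ : All IsInvolution gs′)
           (gs≈gs′ : Pointwise (AgreeOutside E) gs gs′) where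

    open Merging (orbit-isEquivalence invs′) E

    path⇒merge : ∀ {i j} → Star (Move gs) j i → T (merge (orbit gs′) E i j)
    path⇒merge ε = r⇒merge (orbit-complete gs′ ε)
    path⇒merge (mv ◅ path) with moves-agree gs≈gs′ mv
    ... | inj₁ mv′       = merge-respʳ (orbit-complete gs′ (mv′ ◅ ε)) (path⇒merge path)
    ... | inj₂ (Eⱼ , Eᵦ) =
      merge-meets (merge⇒meets Eᵦ (path⇒merge path)) (meets⁺ Eⱼ (orbit-complete gs′ ε))

    meets-transfer : ∀ {i} → T (meets (orbit gs) E i) → T (meets (orbit gs′) E i)
    meets-transfer {i} Mᵢ with anyFin⁻ (λ a → E a ∧ orbit gs i a) Mᵢ
    ... | a , h with to (T-∧ {E a}) h
    ...   | Eₐ , iₐ = merge⇒meets Eₐ (path⇒merge (orbit-sound gs iₐ))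

    merge-orbit⇒ : ⟦ merge (orbit gs) E ⟧ ⇒ ⟦ merge (orbit gs′) E ⟧
    merge-orbit⇒ {i} {j} h with to (T-∨ {orbit gs i j}) h
    ... | inj₁ iⱼ = path⇒merge (orbit-sound gs iⱼ)
    ... | inj₂ MM =
      merge-meets (meets-transfer (proj₁ (to T-∧ MM))) (meets-transfer (proj₂ (to T-∧ MM)))

  orbitCount-≤ : ∀ {gs gs′ : List (Fin n → Fin n)} → All IsInvolution gs → All IsInvolution gs′ →
    Pointwise (AgreeOutside E) gs gs′ → Pointwise (AgreeOutside E) gs′ gs →
    Any (PerfectMatchingOn E) gs → ∀ {x} → T (E x) →
    orbitCount gs ≤ orbitCount gs′ + (⌊ countFin E /2⌋ ∸ 1)
  orbitCount-≤ {gs} {gs′} invs invs′ gs≈gs′ gs′≈gs matching Eₓ = begin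
    orbitCount gs                         ≤⟨ classCount≤merge partner Eₓ ⟩
    classCount (merge (orbit gs) E) + c   ≡⟨ cong (_+ c) merged-equal ⟩
    classCount (merge (orbit gs′) E) + c  ≤⟨ +-monoˡ-≤ c unmerge ⟩
    orbitCount gs′ + c                    ∎
    where
    open ≤-Reasoning
    open Merging (orbit-isEquivalence invs) E using (classCount≤merge)
    open Merging (orbit-isEquivalence invs′) E using () renaming (r⇒merge to r⇒merge′)
    c : ℕ
    c = ⌊ countFin E /2⌋ ∸ 1
    partner : Partnered (orbit gs) E
    partner Eₐ with matching-move matching Eₐ
    ... | b , b≢a , Eᵦ , mv = b , b≢a , Eᵦ , orbit-complete gs (Move-sym invs mv ◅ ε)
    unmerge : classCount (merge (orbit gs′) E) ≤ orbitCount gs′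
    unmerge = classCount-antitone {r = orbit gs′} {merge (orbit gs′) E} r⇒merge′
    merged-equal : classCount (merge (orbit gs) E) ≡ classCount (merge (orbit gs′) E)
    merged-equal = classCount-cong {r = merge (orbit gs) E} {merge (orbit gs′) E}
      (merge-orbit⇒ invs′ gs≈gs′) (merge-orbit⇒ invs gs′≈gs)

Swaps : ∀ {n} → (g₀ g₂ h₀ h₂ : Fin n → Fin n) → Set
Swaps g₀ g₂ h₀ h₂ = ∀ a → (h₀ a ≡ g₀ a × h₂ a ≡ g₂ a) ⊎ (h₀ a ≡ g₂ a × h₂ a ≡ g₀ a)

module _ {n} {g₀ g₂ h₀ h₂ : Fin n → Fin n} where

  Swaps-sym : Swaps g₀ g₂ h₀ h₂ → Swaps h₀ h₂ g₀ g₂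
  Swaps-sym swaps a with swaps a
  ... | inj₁ (h₀≡g₀ , h₂≡g₂) = inj₁ (sym h₀≡g₀ , sym h₂≡g₂)
  ... | inj₂ (h₀≡g₂ , h₂≡g₀) = inj₂ (sym h₂≡g₀ , sym h₀≡g₂)

  Swaps-Move : Swaps g₀ g₂ h₀ h₂ → ∀ hs → Move (g₀ ∷ hs ++ g₂ ∷ []) ⇒ Move (h₀ ∷ hs ++ h₂ ∷ [])
  Swaps-Move swaps hs {a} (here g₀a≡b) with swaps a
  ... | inj₁ (h₀≡g₀ , _) = here (trans h₀≡g₀ g₀a≡b)
  ... | inj₂ (_ , h₂≡g₀) = there (++⁺ʳ hs (here (trans h₂≡g₀ g₀a≡b)))
  Swaps-Move swaps hs {a} (there mv) with ++⁻ hs mv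
  ... | inj₁ middle           = there (++⁺ˡ middle)
  ... | inj₂ (there ())
  ... | inj₂ (here g₂a≡b) with swaps a
  ...   | inj₁ (_ , h₂≡g₂) = there (++⁺ʳ hs (here (trans h₂≡g₂ g₂a≡b)))
  ...   | inj₂ (h₀≡g₂ , _) = here (trans h₀≡g₂ g₂a≡b)

module _ {n} {E : Fin n → Bool} {g h₁ h₂ : Fin n → Fin n}
         (inside : ∀ {a} → T (E a) → g a ≡ h₁ a) (outside : ∀ {a} → ¬ T (E a) → g a ≡ h₂ a) where

  piecewise-involutive : IsInvolution h₁ → IsInvolution h₂ →
    (∀ a → E (h₁ a) ≡ E a) → (∀ a → E (h₂ a) ≡ E a) → IsInvolution g
  piecewise-involutive inv-h₁ inv-h₂ h₁-preserves h₂-preserves a with T? (E a)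
  ... | yes Eₐ  = begin
    g (g a)     ≡⟨ cong g (inside Eₐ) ⟩
    g (h₁ a)    ≡⟨ inside (subst T (sym (h₁-preserves a)) Eₐ) ⟩
    h₁ (h₁ a)   ≡⟨ inv-h₁ a ⟩
    a           ∎
    where open ≡-Reasoning
  ... | no  ¬Eₐ = begin
    g (g a)     ≡⟨ cong g (outside ¬Eₐ) ⟩
    g (h₂ a)    ≡⟨ outside (¬Eₐ ∘ subst T (h₂-preserves a)) ⟩
    h₂ (h₂ a)   ≡⟨ inv-h₂ a ⟩
    a           ∎
    where open ≡-Reasoning

  piecewise-fixedPointFree : FixedPointFree h₁ → FixedPointFree h₂ → FixedPointFree g
  piecewise-fixedPointFree fpf-h₁ fpf-h₂ a with T? (E a)
  ... | yes Eₐ  = fpf-h₁ a ∘ trans (sym (inside Eₐ))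
  ... | no  ¬Eₐ = fpf-h₂ a ∘ trans (sym (outside ¬Eₐ))

-- Hypermaps and their partial duals

eulerGenus-distance : ∀ {H H′ c} → k H ≡ k H′ → d H ≡ d H′ → e H ≡ e H′ →
  v H ≤ v H′ + c → v H′ ≤ v H + c → f H ≤ f H′ + c → f H′ ≤ f H + c →
  ∣ eulerGenus H - eulerGenus H′ ∣ ≤ 2 * c
eulerGenus-distance {H} {H′} {c} k≡ d≡ e≡ v≤ v≥ f≤ f≥ = begin
  ∣ eulerGenus H - eulerGenus H′ ∣
    ≡⟨ cong (λ A′ → ∣ (ℤ.+ A - ℤ.+ P) - (ℤ.+ A′ - ℤ.+ P′) ∣) A≡A′ ⟨
  ∣ (ℤ.+ A - ℤ.+ P) - (ℤ.+ A - ℤ.+ P′) ∣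
    ≡⟨ cong ∣_∣ (sub-sub-cancel (ℤ.+ A) (ℤ.+ P) (ℤ.+ P′)) ⟩
  ∣ ℤ.+ P′ - ℤ.+ P ∣
    ≤⟨ ∣+m-+n∣≤ P′≤P+2c P≤P′+2c ⟩
  2 * c ∎
  where
  open ≤-Reasoning
  A P P′ : ℕ
  A  = 2 * k H + d H
  P  = v H + e H + f H
  P′ = v H′ + e H′ + f H′
  sub-sub-cancel : ∀ (a p q : ℤ) → (a - p) - (a - q) ≡ q - p
  sub-sub-cancel = ℤ-Solver.solve-∀
  A≡A′ : A ≡ 2 * k H′ + d H′
  A≡A′ = cong₂ (λ κ δ → 2 * κ + δ) k≡ d≡
  P′≤P+2c : P′ ≤ P + 2 * c
  P′≤P+2c = subst (λ ε → v H′ + ε + f H′ ≤ P + 2 * c) e≡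
    (+-mono-≤-slack {a′ = v H} {b′ = f H} {m = e H} v≥ f≥)
  P≤P′+2c : P ≤ P′ + 2 * c
  P≤P′+2c = subst (λ ε → P ≤ v H′ + ε + f H′ + 2 * c) e≡
    (+-mono-≤-slack {a′ = v H′} {b′ = f H′} {m = e H} v≤ f≤)

module _ (H : RawHypermap) (ribbon : IsRibbonHypermap H) (x : Fin (nflags H)) where

  open IsRibbonHypermap ribbon

  private
    H* : RawHypermap
    H* = partialDual H x
    E : Fin (nflags H) → Bool
    E = inHyperedge H x

  inHyperedge-τ₀ : ∀ a → E (τ₀ H a) ≡ E a
  inHyperedge-τ₀ a = sym (orbit-resp-Move (inv₀ ∷ inv₂ ∷ []) (here refl))

  inHyperedge-τ₂ : ∀ a → E (τ₂ H a) ≡ E a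
  inHyperedge-τ₂ a = sym (orbit-resp-Move (inv₀ ∷ inv₂ ∷ []) (there (here refl)))

  partialDual-inside : ∀ {a} → T (E a) → τ₀ H* a ≡ τ₂ H a × τ₂ H* a ≡ τ₀ H a
  partialDual-inside Eₐ rewrite to T-≡ Eₐ = refl , refl

  partialDual-outside : ∀ {a} → ¬ T (E a) → τ₀ H* a ≡ τ₀ H a × τ₂ H* a ≡ τ₂ H a
  partialDual-outside ¬Eₐ rewrite ¬T⇒≡false ¬Eₐ = refl , refl

  partialDual-swaps : Swaps (τ₀ H) (τ₂ H) (τ₀ H*) (τ₂ H*)
  partialDual-swaps a with T? (E a)
  ... | yes Eₐ  = inj₂ (partialDual-inside Eₐ)
  ... | no  ¬Eₐ = inj₁ (partialDual-outside ¬Eₐ)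

  inHyperedge-τ₀* : ∀ a → E (τ₀ H* a) ≡ E a
  inHyperedge-τ₀* a with partialDual-swaps a
  ... | inj₁ (τ₀*≡τ₀ , _) = trans (cong E τ₀*≡τ₀) (inHyperedge-τ₀ a)
  ... | inj₂ (τ₀*≡τ₂ , _) = trans (cong E τ₀*≡τ₂) (inHyperedge-τ₂ a)

  inHyperedge-τ₂* : ∀ a → E (τ₂ H* a) ≡ E a
  inHyperedge-τ₂* a with partialDual-swaps a
  ... | inj₁ (_ , τ₂*≡τ₂) = trans (cong E τ₂*≡τ₂) (inHyperedge-τ₂ a)
  ... | inj₂ (_ , τ₂*≡τ₀) = trans (cong E τ₂*≡τ₀) (inHyperedge-τ₀ a)

  partialDual-isRibbonHypermap : IsRibbonHypermap H*
  partialDual-isRibbonHypermap = record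
    { inv₀ = piecewise-involutive inside₀ outside₀ inv₂ inv₀ inHyperedge-τ₂ inHyperedge-τ₀
    ; inv₁ = inv₁
    ; inv₂ = piecewise-involutive inside₂ outside₂ inv₀ inv₂ inHyperedge-τ₀ inHyperedge-τ₂
    ; fpf₀ = piecewise-fixedPointFree inside₀ outside₀ fpf₂ fpf₀
    ; fpf₁ = fpf₁
    ; fpf₂ = piecewise-fixedPointFree inside₂ outside₂ fpf₀ fpf₂
    }
    where
    inside₀ : ∀ {a} → T (E a) → τ₀ H* a ≡ τ₂ H a
    inside₀ = proj₁ ∘ partialDual-inside
    inside₂ : ∀ {a} → T (E a) → τ₂ H* a ≡ τ₀ H a
    inside₂ = proj₂ ∘ partialDual-inside
    outside₀ : ∀ {a} → ¬ T (E a) → τ₀ H* a ≡ τ₀ H a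
    outside₀ = proj₁ ∘ partialDual-outside
    outside₂ : ∀ {a} → ¬ T (E a) → τ₂ H* a ≡ τ₂ H a
    outside₂ = proj₂ ∘ partialDual-outside

  private
    module H* = IsRibbonHypermap partialDual-isRibbonHypermap

    x∈E : T (E x)
    x∈E = orbit-complete (τ₀ H ∷ τ₂ H ∷ []) ε

    agree₁ : AgreeOutside E (τ₁ H) (τ₁ H)
    agree₁ _ = inj₁ refl
    agree₀ : AgreeOutside E (τ₀ H) (τ₀ H*)
    agree₀ = agreeOutside (λ _ → proj₁ ∘ partialDual-outside) inHyperedge-τ₀
    agree₀* : AgreeOutside E (τ₀ H*) (τ₀ H)
    agree₀* = agreeOutside (λ _ → sym ∘ proj₁ ∘ partialDual-outside) inHyperedge-τ₀*
    agree₂ : AgreeOutside E (τ₂ H) (τ₂ H*)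
    agree₂ = agreeOutside (λ _ → proj₂ ∘ partialDual-outside) inHyperedge-τ₂
    agree₂* : AgreeOutside E (τ₂ H*) (τ₂ H)
    agree₂* = agreeOutside (λ _ → sym ∘ proj₂ ∘ partialDual-outside) inHyperedge-τ₂*

  vertices-≤-partialDual : v H ≤ v H* + (degree H x ∸ 1)
  vertices-≤-partialDual = +-monoˡ-≤-slack {b = orbitCount (τ₁ H ∷ τ₂ H* ∷ [])} (isolated H)
    (orbitCount-≤ {E = E} (inv₁ ∷ inv₂ ∷ []) (inv₁ ∷ H*.inv₂ ∷ [])
      (agree₁ ∷ agree₂ ∷ []) (agree₁ ∷ agree₂* ∷ [])
      (there (here (perfectMatchingOn fpf₂ inHyperedge-τ₂))) x∈E)

  vertices-partialDual-≤ : v H* ≤ v H + (degree H x ∸ 1)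
  vertices-partialDual-≤ = +-monoˡ-≤-slack {b = orbitCount (τ₁ H ∷ τ₂ H ∷ [])} (isolated H)
    (orbitCount-≤ {E = E} (inv₁ ∷ H*.inv₂ ∷ []) (inv₁ ∷ inv₂ ∷ [])
      (agree₁ ∷ agree₂* ∷ []) (agree₁ ∷ agree₂ ∷ [])
      (there (here (perfectMatchingOn H*.fpf₂ inHyperedge-τ₂*))) x∈E)

  faces-≤-partialDual : f H ≤ f H* + (degree H x ∸ 1)
  faces-≤-partialDual = +-monoˡ-≤-slack {b = orbitCount (τ₀ H* ∷ τ₁ H ∷ [])} (isolated H)
    (orbitCount-≤ {E = E} (inv₀ ∷ inv₁ ∷ []) (H*.inv₀ ∷ inv₁ ∷ [])
      (agree₀ ∷ agree₁ ∷ []) (agree₀* ∷ agree₁ ∷ [])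
      (here (perfectMatchingOn fpf₀ inHyperedge-τ₀)) x∈E)

  faces-partialDual-≤ : f H* ≤ f H + (degree H x ∸ 1)
  faces-partialDual-≤ = +-monoˡ-≤-slack {b = orbitCount (τ₀ H ∷ τ₁ H ∷ [])} (isolated H)
    (orbitCount-≤ {E = E} (H*.inv₀ ∷ inv₁ ∷ []) (inv₀ ∷ inv₁ ∷ [])
      (agree₀* ∷ agree₁ ∷ []) (agree₀ ∷ agree₁ ∷ [])
      (here (perfectMatchingOn H*.fpf₀ inHyperedge-τ₀*)) x∈E)

  hyperedges-partialDual : e H ≡ e H*
  hyperedges-partialDual = orbitCount-cong
    (Swaps-Move partialDual-swaps []) (Swaps-Move (Swaps-sym partialDual-swaps) [])

  components-partialDual : k H ≡ k H*
  components-partialDual = cong (_+ isolated H) (orbitCount-cong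
    (Swaps-Move partialDual-swaps (τ₁ H ∷ []))
    (Swaps-Move (Swaps-sym partialDual-swaps) (τ₁ H ∷ [])))

proposition3p6 : (H : RawHypermap) → IsRibbonHypermap H → (x : Fin (nflags H))
    → ∣ eulerGenus H - eulerGenus (partialDual H x) ∣ ≤ 2 * (degree H x ∸ 1)
proposition3p6 H ribbon x = eulerGenus-distance {H} {partialDual H x}
  (components-partialDual H ribbon x) refl (hyperedges-partialDual H ribbon x)
  (vertices-≤-partialDual H ribbon x) (vertices-partialDual-≤ H ribbon x)
  (faces-≤-partialDual H ribbon x) (faces-partialDual-≤ H ribbon x)
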